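{- Let $A,B,\gamma\ge0$, let $\{f_{m,n}\}$ be defined by $f_{m,n}=A^mB^n$ if $mn=0$ (with $0^0=1$) and $f_{m,n}=f_{m-1,n}+f_{m,n-1}+\gamma f_{m-1,n-1}$ if $mn>0$, and put $\mathfrak f_m=f_{m,m}$. If $(A,B)\in\{(0,1),(1,0),(0,0),(1,1)\}$, then there exist polynomials $\hat p_0,\hat p_1,\hat p_2$, each of degree at most $2$ and not all identically zero, such that for all sufficiently large $m$, \[ \hat p_0(m)\mathfrak f_m+\hat p_1(m)\mathfrak f_{m-1}+\hat p_2(m)\mathfrak f_{m-2}=0. \] -}

module Defs where

open import Level using (Level; _⊔_)
open import Data.Nat using (ℕ; zero; suc)
open import Data.Product using (∃; _×_)
open import Relation.Nullary using (¬_)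
open import Relation.Binary.Structures using (IsTotalOrder)
open import Algebra.Bundles using (CommutativeRing)

record OrderedField (c ℓ₁ ℓ₂ : Level) : Set (Level.suc (c ⊔ ℓ₁ ⊔ ℓ₂)) where
  field
    commRing : CommutativeRing c ℓ₁
  open CommutativeRing commRing public
  field
    _≤_          : Carrier → Carrier → Set ℓ₂
    isTotalOrder : IsTotalOrder _≈_ _≤_
    +-mono-≤     : ∀ {x y} z → x ≤ y → (x + z) ≤ (y + z)
    *-nonneg     : ∀ {x y} → 0# ≤ x → 0# ≤ y → 0# ≤ (x * y)
    0≉1          : ¬ (0# ≈ 1#)
    inverse      : ∀ x → ¬ (x ≈ 0#) → ∃ λ y → (x * y) ≈ 1#

module _ {c ℓ₁ ℓ₂ : Level} (F : OrderedField c ℓ₁ ℓ₂) where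
  open OrderedField F using (Carrier; _≈_; _+_; _*_; 0#; 1#)

  pow : Carrier → ℕ → Carrier
  pow x zero    = 1#
  pow x (suc n) = x * pow x n

  ι : ℕ → Carrier
  ι zero    = 0#
  ι (suc n) = 1# + ι n

  f : (A B γ : Carrier) → ℕ → ℕ → Carrier
  f A B γ zero    n       = pow A zero * pow B n
  f A B γ (suc m) zero    = pow A (suc m) * pow B zero
  f A B γ (suc m) (suc n) = f A B γ m (suc n) + f A B γ (suc m) n + γ * f A B γ m n

  fd : (A B γ : Carrier) → ℕ → Carrier
  fd A B γ m = f A B γ m m

  record Poly≤2 : Set c where
    constructor poly
    field
      c₀ c₁ c₂ : Carrier

  eval : Poly≤2 → Carrier → Carrier
  eval (poly a b d) x = a + b * x + d * (x * x)

  IsZeroPoly : Poly≤2 → Set ℓ₁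
  IsZeroPoly (poly a b d) = (a ≈ 0#) × ((b ≈ 0#) × (d ≈ 0#))

{-# OPTIONS --safe #-}
module Submission where

-- The γ-Delannoy array D, the solution of the recurrence with all boundary values 1, carries
-- everything. Solutions are determined by their boundary values and the recurrence is linear, so
-- f is D when A = B = 1, γ D(m − 1, n − 1) off the axes when A = B = 0, D(m, n) − D(m − 1, n)
-- when (A, B) = (0, 1), and the transpose of the latter when (A, B) = (1, 0).
-- The contiguity operator (E φ)(m, n) = (m + 1) φ(m + 1, n) − (n + 1) φ(m, n + 1) + γ (m − n) φ(m, n)
-- maps solutions to solutions, and E D vanishes on the boundary, hence everywhere. At (k, k + 1),
-- after eliminating D(k, k + 2) by the recurrence, it is a first-order relation between the
-- diagonal 𝔡_k = D(k, k) and the off-diagonal D(k, k + 1); with 𝔡_{k+1} = 2 D(k, k + 1) + γ 𝔡_k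
-- (symmetry of D) this gives
--   m 𝔡_m − (2 + γ)(2m − 1) 𝔡_{m−1} + γ² (m − 1) 𝔡_{m−2} = 0.
-- The diagonals in the other cases are γ 𝔡_{m−1} and (𝔡_m + γ 𝔡_{m−1}) / 2, and their recurrences
-- are combinations of this one at m and m − 1.

open import Defs
open import Level using (Level; _⊔_)
open import Data.Nat using (ℕ; _∸_) renaming (_≤_ to _≤ℕ_)
open import Data.Product using (Σ; ∃; _×_; _,_)
open import Data.Sum using (_⊎_; inj₁; inj₂)
open import Relation.Nullary using (¬_)

open import Data.Nat as ℕ using (zero; suc; s≤s)
import Data.Nat.Properties as ℕP
open import Data.Integer as ℤ using (ℤ; +_; -[1+_]; +[1+_]; _⊖_; _◃_; sign; ∣_∣)
import Data.Integer.Properties as ℤP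
open import Data.Sign as Sign using (Sign)
open import Data.Maybe using (Maybe; map)
open import Relation.Nullary.Decidable using (dec⇒maybe)
open import Relation.Binary.PropositionalEquality using (cong)
open import Relation.Binary.Structures using (IsTotalOrder)
open import Algebra.Bundles using (CommutativeRing)
open import Algebra.Solver.Ring.AlmostCommutativeRing
  using (fromCommutativeRing; _-Raw-AlmostCommutative⟶_)

module IntegerCoefficients {c ℓ : Level} (R : CommutativeRing c ℓ) where
  open CommutativeRing R
  open import Algebra.Properties.Ring ring
    using (-0#≈0#; -‿involutive; -‿distribˡ-*; -‿distribʳ-*; -‿anti-homo-+; -‿+-comm; xyx⁻¹≈y)
  open import Algebra.Properties.Semiring.Mult.TCOptimised semiring
    using (1+×; ×-homo-+; ×1-homo-*) renaming (_×_ to _times_)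
  open import Relation.Binary.Reasoning.Setoid setoid

  -- `fromℕ 1` is `1#` on the nose (unlike `ι F 1 = 1# + 0#`), so the solver constants `# k`
  -- evaluate to terms written with `1#` and `fromℕ k`.
  fromℕ : ℕ → Carrier
  fromℕ n = n times 1#

  ⟦_⟧ : ℤ → Carrier
  ⟦ + n ⟧      = fromℕ n
  ⟦ -[1+ n ] ⟧ = - fromℕ (suc n)

  [x+y]-[x+z]≈y-z : ∀ x y z → (x + y) - (x + z) ≈ y - z
  [x+y]-[x+z]≈y-z x y z = begin
    (x + y) - (x + z)      ≈⟨ +-congˡ (-‿cong (+-comm x z)) ⟩
    (x + y) - (z + x)      ≈⟨ +-congˡ (-‿anti-homo-+ z x) ⟩
    (x + y) + (- x - z)    ≈⟨ +-assoc (x + y) (- x) (- z) ⟨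
    (x + y - x) - z        ≈⟨ +-congʳ (xyx⁻¹≈y x y) ⟩
    y - z                  ∎

  ⊖-homo : ∀ m n → ⟦ m ⊖ n ⟧ ≈ fromℕ m - fromℕ n
  ⊖-homo zero    zero    = sym (-‿inverseʳ 0#)
  ⊖-homo zero    (suc n) = sym (+-identityˡ _)
  ⊖-homo (suc m) zero    = sym (trans (+-congˡ -0#≈0#) (+-identityʳ _))
  ⊖-homo (suc m) (suc n) = begin
    ⟦ suc m ⊖ suc n ⟧                ≡⟨ cong ⟦_⟧ (ℤP.[1+m]⊖[1+n]≡m⊖n m n) ⟩
    ⟦ m ⊖ n ⟧                        ≈⟨ ⊖-homo m n ⟩
    fromℕ m - fromℕ n                ≈⟨ [x+y]-[x+z]≈y-z 1# _ _ ⟨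
    (1# + fromℕ m) - (1# + fromℕ n)  ≈⟨ +-cong (1+× m 1#) (-‿cong (1+× n 1#)) ⟨
    fromℕ (suc m) - fromℕ (suc n)    ∎

  +-homo : ∀ i j → ⟦ i ℤ.+ j ⟧ ≈ ⟦ i ⟧ + ⟦ j ⟧
  +-homo (+ m)    (+ n)    = ×-homo-+ 1# m n
  +-homo (+ m)    -[1+ n ] = ⊖-homo m (suc n)
  +-homo -[1+ m ] (+ n)    = trans (⊖-homo n (suc m)) (+-comm _ _)
  +-homo -[1+ m ] -[1+ n ] = begin
    - fromℕ (suc (suc (m ℕ.+ n)))      ≡⟨ cong (λ k → - fromℕ (suc k)) (ℕP.+-suc m n) ⟨
    - fromℕ (suc m ℕ.+ suc n)          ≈⟨ -‿cong (×-homo-+ 1# (suc m) (suc n)) ⟩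
    - (fromℕ (suc m) + fromℕ (suc n))  ≈⟨ -‿+-comm _ _ ⟨
    - fromℕ (suc m) - fromℕ (suc n)    ∎

  -‿homo : ∀ i → ⟦ ℤ.- i ⟧ ≈ - ⟦ i ⟧
  -‿homo (+ zero)  = sym -0#≈0#
  -‿homo +[1+ n ]  = refl
  -‿homo -[1+ n ]  = sym (-‿involutive _)

  signed : Sign → Carrier → Carrier
  signed Sign.+ x = x
  signed Sign.- x = - x

  signed-cong : ∀ s {x y} → x ≈ y → signed s x ≈ signed s y
  signed-cong Sign.+ = λ x≈y → x≈y
  signed-cong Sign.- = -‿cong

  signed-* : ∀ s t x y → signed (s Sign.* t) (x * y) ≈ signed s x * signed t y
  signed-* Sign.+ Sign.+ x y = refl
  signed-* Sign.+ Sign.- x y = -‿distribʳ-* x y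
  signed-* Sign.- Sign.+ x y = -‿distribˡ-* x y
  signed-* Sign.- Sign.- x y = begin
    x * y          ≈⟨ -‿involutive _ ⟨
    - - (x * y)    ≈⟨ -‿cong (-‿distribˡ-* x y) ⟩
    - (- x * y)    ≈⟨ -‿distribʳ-* (- x) y ⟩
    - x * - y      ∎

  ⟦◃⟧ : ∀ s n → ⟦ s ◃ n ⟧ ≈ signed s (fromℕ n)
  ⟦◃⟧ Sign.+ zero    = refl
  ⟦◃⟧ Sign.- zero    = sym -0#≈0#
  ⟦◃⟧ Sign.+ (suc n) = refl
  ⟦◃⟧ Sign.- (suc n) = refl

  ⟦⟧≈signed : ∀ i → ⟦ i ⟧ ≈ signed (sign i) (fromℕ ∣ i ∣)
  ⟦⟧≈signed (+ n)    = refl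
  ⟦⟧≈signed -[1+ n ] = refl

  *-homo : ∀ i j → ⟦ i ℤ.* j ⟧ ≈ ⟦ i ⟧ * ⟦ j ⟧
  *-homo i j = begin
    ⟦ s ◃ ∣ i ∣ ℕ.* ∣ j ∣ ⟧                                       ≈⟨ ⟦◃⟧ s (∣ i ∣ ℕ.* ∣ j ∣) ⟩
    signed s (fromℕ (∣ i ∣ ℕ.* ∣ j ∣))                            ≈⟨ signed-cong s (×1-homo-* ∣ i ∣ ∣ j ∣) ⟩
    signed s (fromℕ ∣ i ∣ * fromℕ ∣ j ∣)                          ≈⟨ signed-* (sign i) (sign j) _ _ ⟩
    signed (sign i) (fromℕ ∣ i ∣) * signed (sign j) (fromℕ ∣ j ∣) ≈⟨ *-cong (⟦⟧≈signed i) (⟦⟧≈signed j) ⟨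
    ⟦ i ⟧ * ⟦ j ⟧                                                 ∎
    where
    s : Sign
    s = sign i Sign.* sign j

  homomorphism : ℤ.+-*-rawRing -Raw-AlmostCommutative⟶ fromCommutativeRing R
  homomorphism = record
    { ⟦_⟧    = ⟦_⟧
    ; +-homo = +-homo
    ; *-homo = *-homo
    ; -‿homo = -‿homo
    ; 0-homo = refl
    ; 1-homo = refl
    }

  ⟦⟧-equal? : ∀ i j → Maybe (⟦ i ⟧ ≈ ⟦ j ⟧)
  ⟦⟧-equal? i j = map (λ i≡j → reflexive (cong ⟦_⟧ i≡j)) (dec⇒maybe (i ℤ.≟ j))

  open import Algebra.Solver.Ring ℤ.+-*-rawRing (fromCommutativeRing R) homomorphism ⟦⟧-equal? public
    using (Polynomial; solve; _:=_; con; _:+_; _:*_; _:-_; :-_)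

  #_ : ∀ {n} → ℕ → Polynomial n
  # k = con (+ k)

module _ {c ℓ₁ ℓ₂ : Level} (F : OrderedField c ℓ₁ ℓ₂) where
  open OrderedField F hiding (zero)
  open IntegerCoefficients commRing using (fromℕ; solve; _:=_; #_; _:+_; _:*_; _:-_; :-_)
  open import Algebra.Properties.Ring ring
    using (-0#≈0#; -‿involutive; -1*x≈-x) renaming (x≈y⇒x∙y⁻¹≈ε to x≈y⇒x-y≈0)
  open import Relation.Binary.Reasoning.Setoid setoid
  private module ≤ = IsTotalOrder isTotalOrder

  0≤1 : 0# ≤ 1#
  0≤1 with ≤.total 0# 1#
  ... | inj₁ 0≤1 = 0≤1
  ... | inj₂ 1≤0 = ≤.trans (*-nonneg 0≤-1 0≤-1) (≤.reflexive -1*-1≈1)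
    where
    0≤-1 : 0# ≤ (- 1#)
    0≤-1 = ≤.trans (≤.reflexive (sym (-‿inverseʳ 1#)))
             (≤.trans (+-mono-≤ (- 1#) 1≤0) (≤.reflexive (+-identityˡ (- 1#))))
    -1*-1≈1 : - 1# * - 1# ≈ 1#
    -1*-1≈1 = trans (-1*x≈-x (- 1#)) (-‿involutive 1#)

  2≉0 : ¬ (fromℕ 2 ≈ 0#)
  2≉0 2≈0 = 0≉1 (≤.antisym 0≤1 1≤0)
    where
    1≤0 : 1# ≤ 0#
    1≤0 = ≤.trans (≤.reflexive (sym (+-identityˡ 1#))) (≤.trans (+-mono-≤ 1# 0≤1) (≤.reflexive 2≈0))

  c*x≈0⇒x≈0 : ∀ {c x} → ¬ (c ≈ 0#) → c * x ≈ 0# → x ≈ 0#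
  c*x≈0⇒x≈0 {c} {x} c≉0 cx≈0 with inverse c c≉0
  ... | c⁻¹ , cc⁻¹≈1 = begin
    x              ≈⟨ *-identityˡ x ⟨
    1# * x         ≈⟨ *-congʳ cc⁻¹≈1 ⟨
    c * c⁻¹ * x    ≈⟨ *-congʳ (*-comm c c⁻¹) ⟩
    c⁻¹ * c * x    ≈⟨ *-assoc c⁻¹ c x ⟩
    c⁻¹ * (c * x)  ≈⟨ *-congˡ cx≈0 ⟩
    c⁻¹ * 0#       ≈⟨ zeroʳ c⁻¹ ⟩
    0#             ∎

  +-vanishingʳ : ∀ {x e} → e ≈ 0# → x + e ≈ x
  +-vanishingʳ {x} e≈0 = trans (+-congˡ e≈0) (+-identityʳ x)

  +-vanishing : ∀ {x y} → x ≈ 0# → y ≈ 0# → x + y ≈ 0#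
  +-vanishing x≈0 y≈0 = trans (+-vanishingʳ y≈0) x≈0

  *-vanishing : ∀ c {x} → x ≈ 0# → c * x ≈ 0#
  *-vanishing c x≈0 = trans (*-congˡ x≈0) (zeroʳ c)

  pow-one : ∀ {x} → x ≈ 1# → ∀ n → pow F x n ≈ 1#
  pow-one x≈1 zero    = refl
  pow-one x≈1 (suc n) = trans (*-cong x≈1 (pow-one x≈1 n)) (*-identityˡ 1#)

  pow-zero : ∀ {x} → x ≈ 0# → ∀ n → pow F x (suc n) ≈ 0#
  pow-zero x≈0 n = trans (*-congʳ x≈0) (zeroˡ _)

  PolyRecurrence : Set c
  PolyRecurrence = Poly≤2 F × Poly≤2 F × Poly≤2 F

  Nontrivial : PolyRecurrence → Set ℓ₁
  Nontrivial (p₀ , p₁ , p₂) = ¬ (IsZeroPoly F p₀ × IsZeroPoly F p₁ × IsZeroPoly F p₂)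

  HoldsAt : PolyRecurrence → (ℕ → Carrier) → ℕ → Set ℓ₁
  HoldsAt (p₀ , p₁ , p₂) s m =
    eval F p₀ (ι F m) * s m + eval F p₁ (ι F m) * s (m ∸ 1) + eval F p₂ (ι F m) * s (m ∸ 2) ≈ 0#

  HasPolyRecurrence : (ℕ → Carrier) → Set (c ⊔ ℓ₁)
  HasPolyRecurrence s = Σ (Poly≤2 F) λ p₀ → Σ (Poly≤2 F) λ p₁ → Σ (Poly≤2 F) λ p₂ →
    Nontrivial (p₀ , p₁ , p₂) × ∃ λ (M : ℕ) → ∀ m → M ≤ℕ m → 2 ≤ℕ m → HoldsAt (p₀ , p₁ , p₂) s m

  HoldsAt-cong : ∀ r {s t} m → s m ≈ t m → s (m ∸ 1) ≈ t (m ∸ 1) → s (m ∸ 2) ≈ t (m ∸ 2) →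
                 HoldsAt r s m → HoldsAt r t m
  HoldsAt-cong (p₀ , p₁ , p₂) m e₀ e₁ e₂ =
    trans (sym (+-cong (+-cong (*-congˡ e₀) (*-congˡ e₁)) (*-congˡ e₂)))

  HoldsAt-unscale : ∀ r {s c} m → ¬ (c ≈ 0#) → HoldsAt r (λ j → c * s j) m → HoldsAt r s m
  HoldsAt-unscale (p₀ , p₁ , p₂) {s} {c} m c≉0 holds = c*x≈0⇒x≈0 c≉0 (trans
    (solve 7 (λ e₀ e₁ e₂ c s₀ s₁ s₂ →
       c :* (e₀ :* s₀ :+ e₁ :* s₁ :+ e₂ :* s₂) := e₀ :* (c :* s₀) :+ e₁ :* (c :* s₁) :+ e₂ :* (c :* s₂))
     refl (eval F p₀ (ι F m)) (eval F p₁ (ι F m)) (eval F p₂ (ι F m)) c (s m) (s (m ∸ 1)) (s (m ∸ 2)))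
    holds)

  hasPolyRecurrence : ∀ r {s t} → Nontrivial r → (∀ n → HoldsAt r s (3 ℕ.+ n)) → (∀ m → s m ≈ t m) →
                      HasPolyRecurrence t
  hasPolyRecurrence r@(p₀ , p₁ , p₂) {s} {t} nontrivial holds s≈t =
    p₀ , p₁ , p₂ , nontrivial , 3 , holdsFrom3
    where
    holdsFrom3 : ∀ m → 3 ≤ℕ m → 2 ≤ℕ m → HoldsAt r t m
    holdsFrom3 (suc (suc (suc n))) _ _ = HoldsAt-cong r {s} {t} (3 ℕ.+ n) (s≈t _) (s≈t _) (s≈t _) (holds n)
    holdsFrom3 (suc (suc zero))    (s≤s (s≤s ())) _
    holdsFrom3 (suc zero)          (s≤s ()) _
    holdsFrom3 zero                () _

  module _ (γ : Carrier) where

    Recurrent : (ℕ → ℕ → Carrier) → Set ℓ₁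
    Recurrent φ = ∀ m n → φ (suc m) (suc n) ≈ φ m (suc n) + φ (suc m) n + γ * φ m n

    recurrent-unique : ∀ {φ ψ} → Recurrent φ → Recurrent ψ →
                       (∀ n → φ zero n ≈ ψ zero n) → (∀ m → φ (suc m) zero ≈ ψ (suc m) zero) →
                       ∀ m n → φ m n ≈ ψ m n
    recurrent-unique rφ rψ left bottom zero    n       = left n
    recurrent-unique rφ rψ left bottom (suc m) zero    = bottom m
    recurrent-unique {φ} {ψ} rφ rψ left bottom (suc m) (suc n) = begin
      φ (suc m) (suc n)                      ≈⟨ rφ m n ⟩
      φ m (suc n) + φ (suc m) n + γ * φ m n  ≈⟨ +-cong (+-cong (unique m (suc n)) (unique (suc m) n))
                                                        (*-congˡ (unique m n)) ⟩
      ψ m (suc n) + ψ (suc m) n + γ * ψ m n  ≈⟨ rψ m n ⟨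
      ψ (suc m) (suc n)                      ∎
      where
      unique : ∀ m n → φ m n ≈ ψ m n
      unique = recurrent-unique rφ rψ left bottom

    Recurrent-transpose : ∀ {φ} → Recurrent φ → Recurrent (λ m n → φ n m)
    Recurrent-transpose rφ m n = trans (rφ n m) (+-congʳ (+-comm _ _))

    Recurrent-difference : ∀ {φ ψ} → Recurrent φ → Recurrent ψ → Recurrent (λ m n → φ m n - ψ m n)
    Recurrent-difference {φ} {ψ} rφ rψ m n = trans (+-cong (rφ m n) (-‿cong (rψ m n)))
      (solve 7 (λ g p₁ p₂ p₃ q₁ q₂ q₃ →
         p₁ :+ p₂ :+ g :* p₃ :- (q₁ :+ q₂ :+ g :* q₃) := p₁ :- q₁ :+ (p₂ :- q₂) :+ g :* (p₃ :- q₃))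
       refl γ (φ m (suc n)) (φ (suc m) n) (φ m n) (ψ m (suc n)) (ψ (suc m) n) (ψ m n))

    f-transpose : ∀ A B m n → f F A B γ m n ≈ f F B A γ n m
    f-transpose A B = recurrent-unique (λ _ _ → refl) (Recurrent-transpose (λ _ _ → refl))
      (λ { zero → refl ; (suc n) → *-comm _ _ })
      (λ _ → *-comm _ _)

    D : ℕ → ℕ → Carrier
    D zero    n       = 1#
    D (suc m) zero    = 1#
    D (suc m) (suc n) = D m (suc n) + D (suc m) n + γ * D m n

    D-recurrent : Recurrent D
    D-recurrent _ _ = refl

    D-zeroʳ : ∀ m → D m zero ≈ 1#
    D-zeroʳ zero    = refl
    D-zeroʳ (suc m) = refl

    D-sym : ∀ m n → D m n ≈ D n m
    D-sym = recurrent-unique D-recurrent (Recurrent-transpose D-recurrent)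
      (λ n → sym (D-zeroʳ n)) (λ _ → refl)

    D-oneˡ : ∀ n → D 1 n ≈ 1# + ι F n * (1# + γ)
    D-oneˡ zero    = solve 1 (λ g → # 1 := # 1 :+ # 0 :* (# 1 :+ g)) refl γ
    D-oneˡ (suc n) = trans (+-congʳ (+-congˡ (D-oneˡ n)))
      (solve 2 (λ y g → # 1 :+ (# 1 :+ y :* (# 1 :+ g)) :+ g :* # 1 := # 1 :+ (# 1 :+ y) :* (# 1 :+ g))
       refl (ι F n) γ)

    contiguity : (ℕ → ℕ → Carrier) → ℕ → ℕ → Carrier
    contiguity φ m n =
      ι F (suc m) * φ (suc m) n - ι F (suc n) * φ m (suc n) + γ * (ι F m - ι F n) * φ m n

    contiguity-recurrent : ∀ {φ} → Recurrent φ → Recurrent (contiguity φ)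
    contiguity-recurrent {φ} rφ m n = trans
      (+-cong (+-cong (*-congˡ (rφ (suc m) n)) (-‿cong (*-congˡ (rφ m (suc n))))) (*-congˡ (rφ m n)))
      (solve 9 (λ x y g φ₁₁ φ₂₀ φ₀₂ φ₁₀ φ₀₁ φ₀₀ →
         let X₁ = # 1 :+ x ; X₂ = # 1 :+ X₁ ; Y₁ = # 1 :+ y ; Y₂ = # 1 :+ Y₁ in
         X₂ :* (φ₁₁ :+ φ₂₀ :+ g :* φ₁₀) :- Y₂ :* (φ₀₂ :+ φ₁₁ :+ g :* φ₀₁)
           :+ g :* (X₁ :- Y₁) :* (φ₀₁ :+ φ₁₀ :+ g :* φ₀₀)
         := (X₁ :* φ₁₁ :- Y₂ :* φ₀₂ :+ g :* (x :- Y₁) :* φ₀₁)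
            :+ (X₂ :* φ₂₀ :- Y₁ :* φ₁₁ :+ g :* (X₁ :- y) :* φ₁₀)
            :+ g :* (X₁ :* φ₁₀ :- Y₁ :* φ₀₁ :+ g :* (x :- y) :* φ₀₀))
       refl (ι F m) (ι F n) γ (φ (suc m) (suc n)) (φ (suc (suc m)) n) (φ m (suc (suc n)))
            (φ (suc m) n) (φ m (suc n)) (φ m n))

    contiguity-D : ∀ m n → contiguity D m n ≈ 0#
    contiguity-D zero n = trans (+-congʳ (+-congʳ (*-congˡ (D-oneˡ n))))
      (solve 2 (λ y g →
         (# 1 :+ # 0) :* (# 1 :+ y :* (# 1 :+ g)) :- (# 1 :+ y) :* # 1 :+ g :* (# 0 :- y) :* # 1 := # 0)
       refl (ι F n) γ)
    contiguity-D (suc m) zero =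
      trans (+-congʳ (+-congˡ (-‿cong (*-congˡ (trans (D-sym (suc m) 1) (D-oneˡ (suc m)))))))
      (solve 2 (λ x g →
         (# 1 :+ (# 1 :+ x)) :* # 1 :- (# 1 :+ # 0) :* (# 1 :+ (# 1 :+ x) :* (# 1 :+ g))
           :+ g :* ((# 1 :+ x) :- # 0) :* # 1 := # 0)
       refl (ι F m) γ)
    contiguity-D (suc m) (suc n) = trans (contiguity-recurrent D-recurrent m n)
      (+-vanishing (+-vanishing (contiguity-D m (suc n)) (contiguity-D (suc m) n))
                   (*-vanishing γ (contiguity-D m n)))

    diagonal : (ℕ → ℕ → Carrier) → ℕ → Carrier
    diagonal φ m = φ m m

    d a : ℕ → Carrier
    d = diagonal D
    a k = D k (suc k)

    diagonal-step : ∀ k → d (suc k) ≈ a k + a k + γ * d k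
    diagonal-step k = +-congʳ (+-congˡ (D-sym (suc k) k))

    offdiagonal-step : ∀ k →
      ι F (2 ℕ.+ k) * a (suc k) ≈ (ι F (suc k) + ι F (2 ℕ.+ k)) * d (suc k) + γ * ι F (suc k) * a k
    -- `a (suc k)` unfolds to `D k (2 + k) + d (suc k) + γ * a k`, and the contiguity relation
    -- at (k, k + 1) eliminates `D k (2 + k)`.
    offdiagonal-step k = trans (sym (+-vanishingʳ (contiguity-D k (suc k))))
      (solve 5 (λ x g d₁ a₀ D₀₂ →
         let X₁ = # 1 :+ x ; X₂ = # 1 :+ X₁ in
         X₂ :* (D₀₂ :+ d₁ :+ g :* a₀) :+ (X₁ :* d₁ :- X₂ :* D₀₂ :+ g :* (x :- X₁) :* a₀)
         := (X₁ :+ X₂) :* d₁ :+ g :* X₁ :* a₀)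
       refl (ι F k) γ (d (suc k)) (a k) (D k (2 ℕ.+ k)))

    diagonalRecurrence : PolyRecurrence
    diagonalRecurrence =
      poly 0# 1# 0# ,
      poly (fromℕ 2 + γ) (- (fromℕ 2 * (fromℕ 2 + γ))) 0# ,
      poly (- (γ * γ)) (γ * γ) 0#

    diagonal-nontrivial : Nontrivial diagonalRecurrence
    diagonal-nontrivial ((_ , 1≈0 , _) , _) = 0≉1 (sym 1≈0)

    diagonal-holds : ∀ k → HoldsAt diagonalRecurrence d (2 ℕ.+ k)
    diagonal-holds k = trans
      (solve 7 (λ x g d₀ d₁ d₂ a₀ a₁ →
         let X₁ = # 1 :+ x ; X₂ = # 1 :+ X₁ in
         (# 0 :+ # 1 :* X₂ :+ # 0 :* (X₂ :* X₂)) :* d₂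
         :+ (# 2 :+ g :+ :- (# 2 :* (# 2 :+ g)) :* X₂ :+ # 0 :* (X₂ :* X₂)) :* d₁
         :+ (:- (g :* g) :+ g :* g :* X₂ :+ # 0 :* (X₂ :* X₂)) :* d₀
         := X₂ :* (d₂ :- (a₁ :+ a₁ :+ g :* d₁))
            :+ # 2 :* (X₂ :* a₁ :- ((X₁ :+ X₂) :* d₁ :+ g :* X₁ :* a₀))
            :+ :- (g :* X₁) :* (d₁ :- (a₀ :+ a₀ :+ g :* d₀)))
       refl (ι F k) γ (d k) (d (suc k)) (d (2 ℕ.+ k)) (a k) (a (suc k)))
      (+-vanishing (+-vanishing (*-vanishing _ (x≈y⇒x-y≈0 (diagonal-step (suc k))))
                                (*-vanishing _ (x≈y⇒x-y≈0 (offdiagonal-step k))))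
                   (*-vanishing _ (x≈y⇒x-y≈0 (diagonal-step k))))

    f₁₁≈D : ∀ {A B} → A ≈ 1# → B ≈ 1# → ∀ m n → f F A B γ m n ≈ D m n
    f₁₁≈D A≈1 B≈1 = recurrent-unique (λ _ _ → refl) D-recurrent
      (λ n → trans (*-identityˡ _) (pow-one B≈1 n))
      (λ m → trans (*-identityʳ _) (pow-one A≈1 (suc m)))

    corner : ℕ → ℕ → Carrier
    corner zero    zero    = 1#
    corner zero    (suc n) = 0#
    corner (suc m) zero    = 0#
    corner (suc m) (suc n) = γ * D m n

    corner-recurrent : Recurrent corner
    corner-recurrent zero    zero    = solve 1 (λ g → g :* # 1 := # 0 :+ # 0 :+ g :* # 1) refl γ
    corner-recurrent zero    (suc n) = solve 1 (λ g → g :* # 1 := # 0 :+ g :* # 1 :+ g :* # 0) refl γ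
    corner-recurrent (suc m) zero    =
      trans (solve 1 (λ g → g :* # 1 := g :* # 1 :+ # 0 :+ g :* # 0) refl γ)
            (+-congʳ (+-congʳ (*-congˡ (sym (D-zeroʳ m)))))
    corner-recurrent (suc m) (suc n) = trans (distribˡ γ _ _) (+-congʳ (distribˡ γ _ _))

    f₀₀≈corner : ∀ {A B} → A ≈ 0# → B ≈ 0# → ∀ m n → f F A B γ m n ≈ corner m n
    f₀₀≈corner A≈0 B≈0 = recurrent-unique (λ _ _ → refl) corner-recurrent
      (λ { zero → *-identityˡ 1# ; (suc n) → trans (*-identityˡ _) (pow-zero B≈0 n) })
      (λ m → trans (*-identityʳ _) (pow-zero A≈0 m))

    -- the diagonal recurrence with m replaced by m − 1
    shiftedRecurrence : PolyRecurrence
    shiftedRecurrence =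
      poly (- 1#) 1# 0# ,
      poly (fromℕ 3 * (fromℕ 2 + γ)) (- (fromℕ 2 * (fromℕ 2 + γ))) 0# ,
      poly (- (fromℕ 2 * (γ * γ))) (γ * γ) 0#

    shifted-nontrivial : Nontrivial shiftedRecurrence
    shifted-nontrivial ((_ , 1≈0 , _) , _) = 0≉1 (sym 1≈0)

    corner-holds : ∀ n → HoldsAt shiftedRecurrence (diagonal corner) (3 ℕ.+ n)
    corner-holds n = trans
      (solve 5 (λ y g d₀ d₁ d₂ →
         let Y = # 1 :+ y in
         (:- # 1 :+ # 1 :* Y :+ # 0 :* (Y :* Y)) :* (g :* d₂)
         :+ (# 3 :* (# 2 :+ g) :+ :- (# 2 :* (# 2 :+ g)) :* Y :+ # 0 :* (Y :* Y)) :* (g :* d₁)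
         :+ (:- (# 2 :* (g :* g)) :+ g :* g :* Y :+ # 0 :* (Y :* Y)) :* (g :* d₀)
         := g :* ((# 0 :+ # 1 :* y :+ # 0 :* (y :* y)) :* d₂
                  :+ (# 2 :+ g :+ :- (# 2 :* (# 2 :+ g)) :* y :+ # 0 :* (y :* y)) :* d₁
                  :+ (:- (g :* g) :+ g :* g :* y :+ # 0 :* (y :* y)) :* d₀))
       refl (ι F (2 ℕ.+ n)) γ (d n) (d (suc n)) (d (2 ℕ.+ n)))
      (*-vanishing γ (diagonal-holds n))

    D↓ : ℕ → ℕ → Carrier
    D↓ zero    n = 0#
    D↓ (suc m) n = D m n

    D↓-recurrent : Recurrent D↓
    D↓-recurrent zero    n = solve 1 (λ g → # 1 := # 0 :+ # 1 :+ g :* # 0) refl γ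
    D↓-recurrent (suc m) n = refl

    edge : ℕ → ℕ → Carrier
    edge m n = D m n - D↓ m n

    f₀₁≈edge : ∀ {A B} → A ≈ 0# → B ≈ 1# → ∀ m n → f F A B γ m n ≈ edge m n
    f₀₁≈edge A≈0 B≈1 = recurrent-unique (λ _ _ → refl) (Recurrent-difference D-recurrent D↓-recurrent)
      (λ n → trans (trans (*-identityˡ _) (pow-one B≈1 n)) (sym (+-vanishingʳ -0#≈0#)))
      (λ m → trans (trans (*-identityʳ _) (pow-zero A≈0 m)) (sym (x≈y⇒x-y≈0 (sym (D-zeroʳ m)))))

    -- (2m − 3) times the diagonal recurrence at m plus γ (2m − 1) times it at m − 1,
    -- rewritten in terms of 𝔡_m + γ 𝔡_{m−1}
    edgeRecurrence : PolyRecurrence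
    edgeRecurrence =
      poly 0# (- fromℕ 3) (fromℕ 2) ,
      poly (- (fromℕ 6 + fromℕ 2 * γ)) (fromℕ 16 + fromℕ 8 * γ) (- (fromℕ 8 + fromℕ 4 * γ)) ,
      poly (fromℕ 2 * (γ * γ)) (- (fromℕ 5 * (γ * γ))) (fromℕ 2 * (γ * γ))

    edge-nontrivial : Nontrivial edgeRecurrence
    edge-nontrivial ((_ , _ , 2≈0) , _) = 2≉0 2≈0

    d+γd : ℕ → Carrier
    d+γd m = d m + γ * d (m ∸ 1)

    d+γd-holds : ∀ n → HoldsAt edgeRecurrence d+γd (3 ℕ.+ n)
    d+γd-holds n = trans
      (solve 6 (λ y g d₀ d₁ d₂ d₃ →
         let Y = # 1 :+ y in
         (# 0 :+ :- # 3 :* Y :+ # 2 :* (Y :* Y)) :* (d₃ :+ g :* d₂)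
         :+ (:- (# 6 :+ # 2 :* g) :+ (# 16 :+ # 8 :* g) :* Y :+ :- (# 8 :+ # 4 :* g) :* (Y :* Y))
            :* (d₂ :+ g :* d₁)
         :+ (# 2 :* (g :* g) :+ :- (# 5 :* (g :* g)) :* Y :+ # 2 :* (g :* g) :* (Y :* Y)) :* (d₁ :+ g :* d₀)
         := (# 2 :* Y :- # 3)
              :* ((# 0 :+ # 1 :* Y :+ # 0 :* (Y :* Y)) :* d₃
                  :+ (# 2 :+ g :+ :- (# 2 :* (# 2 :+ g)) :* Y :+ # 0 :* (Y :* Y)) :* d₂
                  :+ (:- (g :* g) :+ g :* g :* Y :+ # 0 :* (Y :* Y)) :* d₁)
            :+ g :* (# 2 :* Y :- # 1)
              :* ((# 0 :+ # 1 :* y :+ # 0 :* (y :* y)) :* d₂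
                  :+ (# 2 :+ g :+ :- (# 2 :* (# 2 :+ g)) :* y :+ # 0 :* (y :* y)) :* d₁
                  :+ (:- (g :* g) :+ g :* g :* y :+ # 0 :* (y :* y)) :* d₀))
       refl (ι F (2 ℕ.+ n)) γ (d n) (d (suc n)) (d (2 ℕ.+ n)) (d (3 ℕ.+ n)))
      (+-vanishing (*-vanishing _ (diagonal-holds (suc n))) (*-vanishing _ (diagonal-holds n)))

    d+γd≈2*edge : ∀ k → d+γd (suc k) ≈ fromℕ 2 * diagonal edge (suc k)
    d+γd≈2*edge k = trans
      (solve 4 (λ g d₀ d₁ a₀ →
         d₁ :+ g :* d₀ := # 2 :* (d₁ :- a₀) :+ (a₀ :+ a₀ :+ g :* d₀ :- d₁))
       refl γ (d k) (d (suc k)) (a k))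
      (+-vanishingʳ (x≈y⇒x-y≈0 (sym (diagonal-step k))))

    edge-holds : ∀ n → HoldsAt edgeRecurrence (diagonal edge) (3 ℕ.+ n)
    edge-holds n = HoldsAt-unscale edgeRecurrence {s = diagonal edge} (3 ℕ.+ n) 2≉0
      (HoldsAt-cong edgeRecurrence {s = d+γd} {t = λ j → fromℕ 2 * diagonal edge j} (3 ℕ.+ n)
        (d+γd≈2*edge (2 ℕ.+ n)) (d+γd≈2*edge (suc n)) (d+γd≈2*edge n) (d+γd-holds n))

    fd-hasPolyRecurrence₁₁ : ∀ {A B} → A ≈ 1# → B ≈ 1# → HasPolyRecurrence (fd F A B γ)
    fd-hasPolyRecurrence₁₁ A≈1 B≈1 = hasPolyRecurrence diagonalRecurrence diagonal-nontrivial
      (λ n → diagonal-holds (suc n))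
      (λ m → sym (f₁₁≈D A≈1 B≈1 m m))

    fd-hasPolyRecurrence₀₀ : ∀ {A B} → A ≈ 0# → B ≈ 0# → HasPolyRecurrence (fd F A B γ)
    fd-hasPolyRecurrence₀₀ A≈0 B≈0 = hasPolyRecurrence shiftedRecurrence shifted-nontrivial corner-holds
      (λ m → sym (f₀₀≈corner A≈0 B≈0 m m))

    fd-hasPolyRecurrence₀₁ : ∀ {A B} → A ≈ 0# → B ≈ 1# → HasPolyRecurrence (fd F A B γ)
    fd-hasPolyRecurrence₀₁ A≈0 B≈1 = hasPolyRecurrence edgeRecurrence edge-nontrivial edge-holds
      (λ m → sym (f₀₁≈edge A≈0 B≈1 m m))

    fd-hasPolyRecurrence₁₀ : ∀ {A B} → A ≈ 1# → B ≈ 0# → HasPolyRecurrence (fd F A B γ)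
    fd-hasPolyRecurrence₁₀ {A} {B} A≈1 B≈0 = hasPolyRecurrence edgeRecurrence edge-nontrivial edge-holds
      (λ m → sym (trans (f-transpose A B m m) (f₀₁≈edge B≈0 A≈1 m m)))

proposition5p9 : {c ℓ₁ ℓ₂ : Level} (F : OrderedField c ℓ₁ ℓ₂) →
    let open OrderedField F in
    (A B γ : Carrier) → 0# ≤ A → 0# ≤ B → 0# ≤ γ →
    (((A ≈ 0#) × (B ≈ 1#)) ⊎ ((A ≈ 1#) × (B ≈ 0#)) ⊎ ((A ≈ 0#) × (B ≈ 0#)) ⊎ ((A ≈ 1#) × (B ≈ 1#))) →
    Σ (Poly≤2 F) λ p₀ → Σ (Poly≤2 F) λ p₁ → Σ (Poly≤2 F) λ p₂ →
      ¬ (IsZeroPoly F p₀ × IsZeroPoly F p₁ × IsZeroPoly F p₂) ×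
      ∃ λ (M : ℕ) → ∀ (m : ℕ) → M ≤ℕ m → 2 ≤ℕ m →
        (eval F p₀ (ι F m) * fd F A B γ m + eval F p₁ (ι F m) * fd F A B γ (m ∸ 1)
          + eval F p₂ (ι F m) * fd F A B γ (m ∸ 2)) ≈ 0#
proposition5p9 F _ _ γ _ _ _ (inj₁ (A≈0 , B≈1))                = fd-hasPolyRecurrence₀₁ F γ A≈0 B≈1
proposition5p9 F _ _ γ _ _ _ (inj₂ (inj₁ (A≈1 , B≈0)))         = fd-hasPolyRecurrence₁₀ F γ A≈1 B≈0
proposition5p9 F _ _ γ _ _ _ (inj₂ (inj₂ (inj₁ (A≈0 , B≈0))))  = fd-hasPolyRecurrence₀₀ F γ A≈0 B≈0
proposition5p9 F _ _ γ _ _ _ (inj₂ (inj₂ (inj₂ (A≈1 , B≈1))))  = fd-hasPolyRecurrence₁₁ F γ A≈1 B≈1
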